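{- Let $n\geqslant 3$ and let $C_n$ be the cycle graph on $n$ vertices. Then (i) $\phi_{\min}(C_n)=1$ and (ii) $\phi_{\max}(C_n)=\lceil (n-1)/2\rceil$.
   Context: All graphs are finite, simple and undirected. A numbering of a graph $G$ with $n$ vertices is a bijection $\pi:V(G)\to\{1,\dots,n\}$. A 2-path $\langle x,u,y\rangle$ of $G$ consists of a middle vertex $u$ and an unordered pair $\{x,y\}$ of two distinct neighbours of $u$ (the endpoints may be adjacent). Given a numbering $\pi$, the 2-path $\langle x,u,y\rangle$ is valid if $\pi(u)<\min(\pi(x),\pi(y))$. The validity $\phi_\pi(G)$ is the number of valid 2-paths of $G$ under $\pi$; $\phi_{\min}(G)$ and $\phi_{\max}(G)$ are the minimum and maximum of $\phi_\pi(G)$ over all numberings $\pi$ of $G$. -}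

module Defs where

open import Data.Nat using (ℕ; zero; suc; _+_; _∸_; _≤_; _<_; s≤s; z≤n)
open import Data.Nat.Properties using (≤-trans; n≤1+n)
open import Data.Fin using (Fin; toℕ; _<?_)
open import Data.Fin.Permutation using (Permutation′; _⟨$⟩ʳ_)
open import Data.List using (List; map)
open import Data.Nat.ListAction using (sum)
open import Data.List.Base using ()
open import Data.Fin.Base using ()
open import Data.Product using (_×_; _,_; Σ; ∃)
open import Data.Sum using (_⊎_; inj₁; inj₂)
open import Data.Empty using (⊥)
open import Relation.Nullary using (¬_; Dec; does; _×-dec_; _⊎-dec_)
open import Relation.Binary.PropositionalEquality using (_≡_; refl; sym; trans; cong)
import Data.Nat as N
import Data.List as L
open import Data.Bool using (if_then_else_)

record Graph (n : ℕ) : Set₁ where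
  field
    Adj    : Fin n → Fin n → Set
    adj?   : (u v : Fin n) → Dec (Adj u v)
    symm   : ∀ {u v} → Adj u v → Adj v u
    irrefl : ∀ {u} → ¬ Adj u u
open Graph public

-- A numbering of G (n vertices) is a bijection V(G) → {1,…,n}; we use
-- {0,…,n-1} (Fin n), which has the same order and hence the same valid 2-paths.
Numbering : ℕ → Set
Numbering n = Permutation′ n

ΣFin : {n : ℕ} → (Fin n → ℕ) → ℕ
ΣFin {n} f = sum (map f (L.allFin n))

𝟙 : {P : Set} → Dec P → ℕ
𝟙 d = if does d then 1 else 0

-- The 2-path ⟨x,u,y⟩ with middle u and unordered pair {x,y} of distinct
-- neighbours is counted once by requiring x < y (as indices in Fin n).
-- It is valid iff π(u) < π(x) and π(u) < π(y).
ValidTwoPath : {n : ℕ} → Graph n → Numbering n → Fin n → Fin n → Fin n → Set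
ValidTwoPath G π u x y =
  (toℕ x N.< toℕ y) × (Adj G u x × Adj G u y) ×
  ((π ⟨$⟩ʳ u) Data.Fin.< (π ⟨$⟩ʳ x) × (π ⟨$⟩ʳ u) Data.Fin.< (π ⟨$⟩ʳ y))

validTwoPath? : {n : ℕ} (G : Graph n) (π : Numbering n) (u x y : Fin n) →
                Dec (ValidTwoPath G π u x y)
validTwoPath? G π u x y =
  (toℕ x N.<? toℕ y) ×-dec ((adj? G u x ×-dec adj? G u y) ×-dec
    ((π ⟨$⟩ʳ u) <? (π ⟨$⟩ʳ x) ×-dec (π ⟨$⟩ʳ u) <? (π ⟨$⟩ʳ y)))

validity : {n : ℕ} → Graph n → Numbering n → ℕ
validity G π =
  ΣFin λ u → ΣFin λ x → ΣFin λ y → 𝟙 (validTwoPath? G π u x y)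

IsPhiMin : {n : ℕ} → Graph n → ℕ → Set
IsPhiMin {n} G k = (Σ (Numbering n) λ π → validity G π ≡ k) ×
                   (∀ (π : Numbering n) → k ≤ validity G π)

IsPhiMax : {n : ℕ} → Graph n → ℕ → Set
IsPhiMax {n} G k = (Σ (Numbering n) λ π → validity G π ≡ k) ×
                   (∀ (π : Numbering n) → validity G π ≤ k)

CycAdj : (n : ℕ) → Fin n → Fin n → Set
CycAdj n u v = (toℕ v ≡ suc (toℕ u)) ⊎ (toℕ u ≡ suc (toℕ v)) ⊎
               ((toℕ u ≡ 0 × toℕ v ≡ n ∸ 1) ⊎ (toℕ v ≡ 0 × toℕ u ≡ n ∸ 1))

private
  n≢suc : ∀ {m : ℕ} → ¬ (m ≡ suc m)
  n≢suc ()

  cyc-irrefl : ∀ {n} → 3 ≤ n → ∀ {u : Fin n} → ¬ CycAdj n u u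
  cyc-irrefl _ (inj₁ e) = n≢suc e
  cyc-irrefl _ (inj₂ (inj₁ e)) = n≢suc e
  cyc-irrefl {suc (suc (suc k))} (s≤s (s≤s (s≤s z≤n))) {u} (inj₂ (inj₂ (inj₁ (e , e′)))) with trans (sym e) e′
  ... | ()
  cyc-irrefl {suc (suc (suc k))} (s≤s (s≤s (s≤s z≤n))) {u} (inj₂ (inj₂ (inj₂ (e , e′)))) with trans (sym e) e′
  ... | ()

  cyc-sym : ∀ {n} {u v : Fin n} → CycAdj n u v → CycAdj n v u
  cyc-sym (inj₁ e) = inj₂ (inj₁ e)
  cyc-sym (inj₂ (inj₁ e)) = inj₁ e
  cyc-sym (inj₂ (inj₂ (inj₁ p))) = inj₂ (inj₂ (inj₂ p))
  cyc-sym (inj₂ (inj₂ (inj₂ p))) = inj₂ (inj₂ (inj₁ p))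

  cyc? : ∀ n (u v : Fin n) → Dec (CycAdj n u v)
  cyc? n u v = (toℕ v N.≟ suc (toℕ u)) ⊎-dec (toℕ u N.≟ suc (toℕ v)) ⊎-dec
    (((toℕ u N.≟ 0) ×-dec (toℕ v N.≟ n ∸ 1)) ⊎-dec ((toℕ v N.≟ 0) ×-dec (toℕ u N.≟ n ∸ 1)))

Cycle : (n : ℕ) → 3 ≤ n → Graph n
Cycle n h = record
  { Adj = CycAdj n ; adj? = cyc? n ; symm = cyc-sym ; irrefl = cyc-irrefl h }

-- A vertex with exactly two neighbours is the middle of exactly one 2-path, and that
-- 2-path is valid iff the vertex is a local minimum of π. In C_n every vertex has two
-- neighbours, so φ_π(C_n) counts the local minima of π. Adjacent vertices cannot both be
-- local minima, so there are at most ⌊n/2⌋ = ⌈(n-1)/2⌉ of them, and the vertex numbered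
-- first is one. The identity numbering has vertex 0 as its only local minimum, while
-- numbering along the involution (1 2)(3 4)⋯ makes all ⌊n/2⌋ vertices 2t with
-- 2t + 1 < n local minima.
module Submission where

open import Defs
open import Data.Nat using (ℕ; _≤_; _∸_; ⌈_/2⌉)
open import Data.Product using (_×_)
open import Data.Nat using (zero; suc; _+_; _<_; z≤n; s≤s; s≤s⁻¹; ⌊_/2⌋; _≤?_; _≟_)
open import Data.Nat.Properties
open import Data.Fin as F using (Fin; toℕ; inject₁; fromℕ; fromℕ<)
import Data.Fin.Properties as Finₚ
open import Data.List using (tabulate)
open import Data.List.Properties using (map-tabulate)
open import Data.Nat.ListAction using (sum)
open import Data.Product using (Σ; ∃₂; _,_; proj₁; proj₂)
open import Data.Sum using (_⊎_; inj₁; inj₂; [_,_]′)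
open import Data.Empty using (⊥; ⊥-elim)
open import Function using (id; _∘_)
open import Relation.Nullary using (Dec; yes; no)
open import Relation.Binary.PropositionalEquality
open import Data.Fin.Permutation using (_⟨$⟩ʳ_; _⟨$⟩ˡ_; inverseˡ; inverseʳ; permutation)
import Data.Fin.Permutation as Perm

ΣFin-suc : ∀ {n} (f : Fin (suc n) → ℕ) → ΣFin f ≡ f F.zero + ΣFin (f ∘ F.suc)
ΣFin-suc f = begin
  ΣFin f                                ≡⟨ cong sum (map-tabulate id f) ⟩
  f F.zero + sum (tabulate (f ∘ F.suc)) ≡⟨ cong (f F.zero +_) (cong sum (map-tabulate id (f ∘ F.suc))) ⟨
  f F.zero + ΣFin (f ∘ F.suc)           ∎
  where open ≡-Reasoning

ΣFin-inject₁ : ∀ {n} (f : Fin (suc n) → ℕ) → ΣFin f ≡ ΣFin (f ∘ inject₁) + f (fromℕ n)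
ΣFin-inject₁ {zero} f = trans (ΣFin-suc f) (+-comm (f F.zero) 0)
ΣFin-inject₁ {suc n} f = begin
  ΣFin f                                                     ≡⟨ ΣFin-suc f ⟩
  f F.zero + ΣFin (f ∘ F.suc)                                ≡⟨ cong (f F.zero +_) (ΣFin-inject₁ (f ∘ F.suc)) ⟩
  f F.zero + (ΣFin (f ∘ F.suc ∘ inject₁) + f (fromℕ (suc n))) ≡⟨ +-assoc (f F.zero) _ _ ⟨
  f F.zero + ΣFin (f ∘ F.suc ∘ inject₁) + f (fromℕ (suc n))   ≡⟨ cong (_+ f (fromℕ (suc n))) (ΣFin-suc (f ∘ inject₁)) ⟨
  ΣFin (f ∘ inject₁) + f (fromℕ (suc n))                     ∎
  where open ≡-Reasoning

ΣFin-tail : ∀ {n} (f : Fin (suc n) → ℕ) → f F.zero ≡ 0 → ΣFin f ≡ ΣFin (f ∘ F.suc)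
ΣFin-tail f f0≡0 = trans (ΣFin-suc f) (cong (_+ ΣFin (f ∘ F.suc)) f0≡0)

≤ΣFin : ∀ {n} (f : Fin n → ℕ) i → f i ≤ ΣFin f
≤ΣFin f F.zero    = ≤-trans (m≤m+n _ _) (≤-reflexive (sym (ΣFin-suc f)))
≤ΣFin f (F.suc i) = ≤-trans (≤ΣFin (f ∘ F.suc) i) (≤-trans (m≤n+m _ _) (≤-reflexive (sym (ΣFin-suc f))))

ΣFin-support : ∀ {n} (f : Fin n → ℕ) → 1 ≤ ΣFin f → Σ (Fin n) λ i → 1 ≤ f i
ΣFin-support {zero} f ()
ΣFin-support {suc n} f 1≤Σf with 1 ≤? f F.zero
... | yes 1≤f0 = F.zero , 1≤f0
... | no  f0<1 =
  let i , 1≤fi = ΣFin-support (f ∘ F.suc) (subst (1 ≤_) (ΣFin-tail f (n<1⇒n≡0 (≰⇒> f0<1))) 1≤Σf)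
  in F.suc i , 1≤fi

ΣFin-≤1 : ∀ {n} (f : Fin n → ℕ) → (∀ i → f i ≤ 1) → (∀ i j → 1 ≤ f i → 1 ≤ f j → i ≡ j) → ΣFin f ≤ 1
ΣFin-≤1 {zero} f _ _ = z≤n
ΣFin-≤1 {suc n} f f≤1 unique with 1 ≤? f F.zero
... | no f0<1 = begin
  ΣFin f                      ≡⟨ ΣFin-tail f (n<1⇒n≡0 (≰⇒> f0<1)) ⟩
  ΣFin (f ∘ F.suc)            ≤⟨ ΣFin-≤1 (f ∘ F.suc) (f≤1 ∘ F.suc) (λ i j p q → Finₚ.suc-injective (unique _ _ p q)) ⟩
  1                           ∎
  where open ≤-Reasoning
... | yes 1≤f0 = begin
  ΣFin f                      ≡⟨ ΣFin-suc f ⟩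
  f F.zero + ΣFin (f ∘ F.suc) ≡⟨ cong (f F.zero +_) tail≡0 ⟩
  f F.zero + 0                ≡⟨ +-identityʳ _ ⟩
  f F.zero                    ≤⟨ f≤1 F.zero ⟩
  1                           ∎
  where
  open ≤-Reasoning
  tail≡0 : ΣFin (f ∘ F.suc) ≡ 0
  tail≡0 = n<1⇒n≡0 (≰⇒> λ 1≤tail →
    let i , 1≤fi = ΣFin-support (f ∘ F.suc) 1≤tail in Finₚ.0≢1+n (unique F.zero (F.suc i) 1≤f0 1≤fi))

𝟙≤1 : ∀ {P : Set} (P? : Dec P) → 𝟙 P? ≤ 1
𝟙≤1 (yes _) = s≤s z≤n
𝟙≤1 (no _)  = z≤n

𝟙-toWitness : ∀ {P : Set} (P? : Dec P) → 1 ≤ 𝟙 P? → P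
𝟙-toWitness (yes p) _ = p

𝟙-fromWitness : ∀ {P : Set} (P? : Dec P) → P → 1 ≤ 𝟙 P?
𝟙-fromWitness (yes _) _ = s≤s z≤n
𝟙-fromWitness (no ¬p) p = ⊥-elim (¬p p)

module _ {n} {P : Fin n → Fin n → Set} (P? : ∀ x y → Dec (P x y)) where

  pairCount : ℕ
  pairCount = ΣFin λ x → ΣFin λ y → 𝟙 (P? x y)

  private
    row : Fin n → ℕ
    row x = ΣFin λ y → 𝟙 (P? x y)

    row-support : ∀ x → 1 ≤ row x → Σ (Fin n) (P x)
    row-support x 1≤row = let y , 1≤𝟙 = ΣFin-support _ 1≤row in y , 𝟙-toWitness (P? x y) 1≤𝟙

  pairCount-support : 1 ≤ pairCount → ∃₂ P
  pairCount-support 1≤count = let x , 1≤row = ΣFin-support row 1≤count in x , row-support x 1≤row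

  pairCount-≥1 : ∀ {x y} → P x y → 1 ≤ pairCount
  pairCount-≥1 {x} {y} p = ≤-trans (𝟙-fromWitness (P? x y) p) (≤-trans (≤ΣFin _ y) (≤ΣFin row x))

  pairCount-≤1 : (∀ {x y x′ y′} → P x y → P x′ y′ → x ≡ x′ × y ≡ y′) → pairCount ≤ 1
  pairCount-≤1 unique = ΣFin-≤1 row row≤1 λ x x′ p q →
    let _ , pxy = row-support x p; _ , px′y′ = row-support x′ q in proj₁ (unique pxy px′y′)
    where
    row≤1 : ∀ x → row x ≤ 1
    row≤1 x = ΣFin-≤1 _ (λ y → 𝟙≤1 (P? x y)) λ y y′ p q →
      proj₂ (unique (𝟙-toWitness (P? x y) p) (𝟙-toWitness (P? x y′) q))

≡1∧+≤1⇒≡0 : ∀ {a b} → a ≡ 1 → a + b ≤ 1 → b ≡ 0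
≡1∧+≤1⇒≡0 refl (s≤s b≤0) = n≤0⇒n≡0 b≤0

≤1⇒≡0⊎≡1 : ∀ {a} → a ≤ 1 → a ≡ 0 ⊎ a ≡ 1
≤1⇒≡0⊎≡1 z≤n       = inj₁ refl
≤1⇒≡0⊎≡1 (s≤s z≤n) = inj₂ refl

+≤1 : ∀ {a b} → a ≤ 1 → b ≤ 1 → (1 ≤ a → 1 ≤ b → ⊥) → a + b ≤ 1
+≤1 z≤n       b≤1       _ = b≤1
+≤1 (s≤s z≤n) z≤n       _ = s≤s z≤n
+≤1 (s≤s z≤n) (s≤s z≤n) ¬both = ⊥-elim (¬both (s≤s z≤n) (s≤s z≤n))

path-independent≤⌈/2⌉ : ∀ {n} (f : Fin n → ℕ) → (∀ i → f i ≤ 1) →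
                        (∀ i j → toℕ j ≡ suc (toℕ i) → f i + f j ≤ 1) → ΣFin f ≤ ⌈ n /2⌉
path-independent≤⌈/2⌉ {zero} f _ _ = z≤n
path-independent≤⌈/2⌉ {suc zero} f f≤1 _ = ≤-trans (≤-reflexive (ΣFin-suc f)) (subst (_≤ 1) (sym (+-identityʳ _)) (f≤1 F.zero))
path-independent≤⌈/2⌉ {suc (suc n)} f f≤1 indep =
  [ head≡0 (path-independent≤⌈/2⌉ (f ∘ F.suc) (f≤1 ∘ F.suc) (λ i j e → indep _ _ (cong suc e))) , head≡1 ]′
    (≤1⇒≡0⊎≡1 (f≤1 F.zero))
  where
  open ≤-Reasoning
  head≡0 : ΣFin (f ∘ F.suc) ≤ ⌈ 1 + n /2⌉ → f F.zero ≡ 0 → ΣFin f ≤ ⌈ 2 + n /2⌉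
  head≡0 tail≤ f0≡0 = begin
    ΣFin f           ≡⟨ ΣFin-tail f f0≡0 ⟩
    ΣFin (f ∘ F.suc) ≤⟨ tail≤ ⟩
    ⌈ 1 + n /2⌉      ≤⟨ ⌈n/2⌉-mono (n≤1+n _) ⟩
    ⌈ 2 + n /2⌉      ∎
  head≡1 : f F.zero ≡ 1 → ΣFin f ≤ ⌈ 2 + n /2⌉
  head≡1 f0≡1 = begin
    ΣFin f                       ≡⟨ ΣFin-suc f ⟩
    f F.zero + ΣFin (f ∘ F.suc)  ≡⟨ cong₂ _+_ f0≡1 (ΣFin-tail (f ∘ F.suc) (≡1∧+≤1⇒≡0 f0≡1 (indep F.zero (F.suc F.zero) refl))) ⟩
    1 + ΣFin (f ∘ F.suc ∘ F.suc) ≤⟨ +-monoʳ-≤ 1 (path-independent≤⌈/2⌉ (f ∘ F.suc ∘ F.suc) (f≤1 ∘ F.suc ∘ F.suc)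
                                                                      (λ i j e → indep _ _ (cong (2 +_) e))) ⟩
    ⌈ 2 + n /2⌉                  ∎

cycle-independent≤⌈/2⌉ : ∀ {m} (f : Fin (3 + m) → ℕ) → (∀ i → f i ≤ 1) →
                         (∀ i j → CycAdj (3 + m) i j → f i + f j ≤ 1) → ΣFin f ≤ ⌈ 2 + m /2⌉
cycle-independent≤⌈/2⌉ {m} f f≤1 indep with ≤1⇒≡0⊎≡1 (f≤1 F.zero)
... | inj₁ f0≡0 = begin
  ΣFin f           ≡⟨ ΣFin-tail f f0≡0 ⟩
  ΣFin (f ∘ F.suc) ≤⟨ path-independent≤⌈/2⌉ (f ∘ F.suc) (f≤1 ∘ F.suc) (λ i j e → indep _ _ (inj₁ (cong suc e))) ⟩
  ⌈ 2 + m /2⌉      ∎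
  where open ≤-Reasoning
... | inj₂ f0≡1 = begin
  ΣFin f                                     ≡⟨ ΣFin-suc f ⟩
  f F.zero + ΣFin (f ∘ F.suc)                ≡⟨ cong₂ _+_ f0≡1 (ΣFin-tail (f ∘ F.suc) f1≡0) ⟩
  1 + ΣFin inner                             ≡⟨ cong (1 +_) (ΣFin-inject₁ inner) ⟩
  1 + (ΣFin (inner ∘ inject₁) + f last)      ≡⟨ cong (λ a → 1 + (ΣFin (inner ∘ inject₁) + a)) flast≡0 ⟩
  1 + (ΣFin (inner ∘ inject₁) + 0)           ≡⟨ cong (1 +_) (+-identityʳ _) ⟩
  1 + ΣFin (inner ∘ inject₁)                 ≤⟨ +-monoʳ-≤ 1 (path-independent≤⌈/2⌉ (inner ∘ inject₁) (f≤1 ∘ F.suc ∘ F.suc ∘ inject₁) inner-indep) ⟩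
  ⌈ 2 + m /2⌉                                ∎
  where
  open ≤-Reasoning
  inner : Fin (suc m) → ℕ
  inner = f ∘ F.suc ∘ F.suc
  last : Fin (3 + m)
  last = F.suc (F.suc (fromℕ m))
  f1≡0 : f (F.suc F.zero) ≡ 0
  f1≡0 = ≡1∧+≤1⇒≡0 f0≡1 (indep F.zero (F.suc F.zero) (inj₁ refl))
  flast≡0 : f last ≡ 0
  flast≡0 = ≡1∧+≤1⇒≡0 f0≡1 (indep F.zero last (inj₂ (inj₂ (inj₁ (refl , cong (2 +_) (Finₚ.toℕ-fromℕ m))))))
  inner-indep : ∀ i j → toℕ j ≡ suc (toℕ i) → inner (inject₁ i) + inner (inject₁ j) ≤ 1
  inner-indep i j e = indep _ _ (inj₁ (cong (2 +_) (begin-equality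
    toℕ (inject₁ j) ≡⟨ Finₚ.toℕ-inject₁ j ⟩
    toℕ j           ≡⟨ e ⟩
    suc (toℕ i)     ≡⟨ cong suc (Finₚ.toℕ-inject₁ i) ⟨
    suc (toℕ (inject₁ i)) ∎)))

data Even : ℕ → Set where
  even-zero : Even 0
  even-2+   : ∀ {k} → Even k → Even (2 + k)

⌊/2⌋≤ΣFin-even : ∀ {n} (f : Fin n → ℕ) → (∀ i → Even (toℕ i) → suc (toℕ i) < n → 1 ≤ f i) → ⌊ n /2⌋ ≤ ΣFin f
⌊/2⌋≤ΣFin-even {zero} f _ = z≤n
⌊/2⌋≤ΣFin-even {suc zero} f _ = z≤n
⌊/2⌋≤ΣFin-even {suc (suc n)} f even⇒1≤ = begin
  1 + ⌊ n /2⌋                           ≤⟨ +-mono-≤ (even⇒1≤ F.zero even-zero (s≤s (s≤s z≤n)))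
                                                     (⌊/2⌋≤ΣFin-even (f ∘ F.suc ∘ F.suc) λ i e i<n → even⇒1≤ _ (even-2+ e) (s≤s (s≤s i<n))) ⟩
  f F.zero + ΣFin (f ∘ F.suc ∘ F.suc)   ≤⟨ +-monoʳ-≤ (f F.zero) (m≤n+m _ _) ⟩
  f F.zero + (f (F.suc F.zero) + ΣFin (f ∘ F.suc ∘ F.suc)) ≡⟨ cong (f F.zero +_) (ΣFin-suc (f ∘ F.suc)) ⟨
  f F.zero + ΣFin (f ∘ F.suc)           ≡⟨ ΣFin-suc f ⟨
  ΣFin f                                ∎
  where open ≤-Reasoning

twoPathsAt : ∀ {n} → Graph n → Numbering n → Fin n → ℕ
twoPathsAt G π u = pairCount (validTwoPath? G π u)

LocalMin : ∀ {n} → Graph n → Numbering n → Fin n → Set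
LocalMin G π u = ∀ z → Adj G u z → π ⟨$⟩ʳ u F.< π ⟨$⟩ʳ z

localMin-independent : ∀ {n} (G : Graph n) (π : Numbering n) {u v} →
                       Adj G u v → LocalMin G π u → LocalMin G π v → ⊥
localMin-independent G π uv min-u min-v = <-asym (min-u _ uv) (min-v _ (symm G uv))

minimum-localMin : ∀ {n} (G : Graph (suc n)) (π : Numbering (suc n)) → LocalMin G π (π ⟨$⟩ˡ F.zero)
minimum-localMin G π z adj rewrite inverseʳ π {F.zero} with π ⟨$⟩ʳ z in πz≡0
... | F.zero  = ⊥-elim (irrefl G (subst (Adj G _) (trans (sym (inverseˡ π)) (cong (π ⟨$⟩ˡ_) πz≡0)) adj))
... | F.suc _ = s≤s z≤n

record TwoNeighbours {n} (G : Graph n) (u : Fin n) : Set where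
  field
    left right  : Fin n
    left<right  : toℕ left < toℕ right
    adj-left    : Adj G u left
    adj-right   : Adj G u right
    neighbours  : ∀ {z} → Adj G u z → z ≡ left ⊎ z ≡ right

module _ {n} (G : Graph n) (π : Numbering n) {u} (nb : TwoNeighbours G u) where
  open TwoNeighbours nb

  private
    ordered-neighbours : ∀ {x y} → toℕ x < toℕ y → Adj G u x → Adj G u y → x ≡ left × y ≡ right
    ordered-neighbours {x} {y} x<y ux uy with neighbours ux | neighbours uy
    ... | inj₁ refl | inj₁ refl = ⊥-elim (<-irrefl refl x<y)
    ... | inj₁ refl | inj₂ refl = refl , refl
    ... | inj₂ refl | inj₁ refl = ⊥-elim (<-asym x<y left<right)
    ... | inj₂ refl | inj₂ refl = ⊥-elim (<-irrefl refl x<y)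

  twoPathsAt-≤1 : twoPathsAt G π u ≤ 1
  twoPathsAt-≤1 = pairCount-≤1 (validTwoPath? G π u) λ (x<y , (ux , uy) , _) (x′<y′ , (ux′ , uy′) , _) →
    let x≡l , y≡r = ordered-neighbours x<y ux uy; x′≡l , y′≡r = ordered-neighbours x′<y′ ux′ uy′
    in trans x≡l (sym x′≡l) , trans y≡r (sym y′≡r)

  twoPathsAt⇒localMin : 1 ≤ twoPathsAt G π u → LocalMin G π u
  twoPathsAt⇒localMin 1≤paths z uz with pairCount-support (validTwoPath? G π u) 1≤paths
  ... | x , y , x<y , (ux , uy) , (u<x , u<y) with ordered-neighbours x<y ux uy | neighbours uz
  ...   | refl , refl | inj₁ refl = u<x
  ...   | refl , refl | inj₂ refl = u<y

  localMin⇒twoPathsAt : LocalMin G π u → 1 ≤ twoPathsAt G π u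
  localMin⇒twoPathsAt min-u = pairCount-≥1 (validTwoPath? G π u)
    (left<right , (adj-left , adj-right) , (min-u _ adj-left , min-u _ adj-right))

1≤validity : ∀ {n} (G : Graph (suc n)) → (∀ u → TwoNeighbours G u) → ∀ π → 1 ≤ validity G π
1≤validity {n} G nb π = ≤-trans (localMin⇒twoPathsAt G π (nb u) (minimum-localMin G π)) (≤ΣFin (twoPathsAt G π) u)
  where
  u : Fin (suc n)
  u = π ⟨$⟩ˡ F.zero

-- CycAdj n u v unfolds to CycAdjℕ n (toℕ u) (toℕ v).
CycAdjℕ : ℕ → ℕ → ℕ → Set
CycAdjℕ n k j = (j ≡ suc k) ⊎ (k ≡ suc j) ⊎ ((k ≡ 0 × j ≡ n ∸ 1) ⊎ (j ≡ 0 × k ≡ n ∸ 1))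

record CycleNeighboursℕ (m k : ℕ) : Set where
  field
    left right  : ℕ
    left<right  : left < right
    right<n     : right < 3 + m
    adj-left    : CycAdjℕ (3 + m) k left
    adj-right   : CycAdjℕ (3 + m) k right
    neighbours  : ∀ {j} → j < 3 + m → CycAdjℕ (3 + m) k j → j ≡ left ⊎ j ≡ right

cycle-neighboursℕ : ∀ {m} k → k < 3 + m → CycleNeighboursℕ m k
cycle-neighboursℕ {m} zero _ = record
  { left = 1 ; right = 2 + m ; left<right = s≤s (s≤s z≤n) ; right<n = ≤-refl
  ; adj-left = inj₁ refl ; adj-right = inj₂ (inj₂ (inj₁ (refl , refl))) ; neighbours = only }
  where
  only : ∀ {j} → j < 3 + m → CycAdjℕ (3 + m) 0 j → j ≡ 1 ⊎ j ≡ 2 + m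
  only _ (inj₁ j≡1)                        = inj₁ j≡1
  only _ (inj₂ (inj₂ (inj₁ (_ , j≡last)))) = inj₂ j≡last
  only _ (inj₂ (inj₂ (inj₂ (_ , ()))))
cycle-neighboursℕ {m} (suc k) k<n with k ≟ suc m
... | yes refl = record
  { left = 0 ; right = suc m ; left<right = s≤s z≤n ; right<n = s≤s (s≤s (n≤1+n m))
  ; adj-left = inj₂ (inj₂ (inj₂ (refl , refl))) ; adj-right = inj₂ (inj₁ refl) ; neighbours = only }
  where
  only : ∀ {j} → j < 3 + m → CycAdjℕ (3 + m) (2 + m) j → j ≡ 0 ⊎ j ≡ suc m
  only j<n (inj₁ refl)                    = ⊥-elim (<-irrefl refl j<n)
  only _   (inj₂ (inj₁ e))                = inj₂ (sym (suc-injective e))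
  only _   (inj₂ (inj₂ (inj₂ (j≡0 , _)))) = inj₁ j≡0
... | no k≢1+m = record
  { left = k ; right = 2 + k ; left<right = ≤-trans (n<1+n k) (n≤1+n (suc k))
  ; right<n = s≤s (s≤s (≤∧≢⇒< (s≤s⁻¹ (s≤s⁻¹ k<n)) k≢1+m))
  ; adj-left = inj₂ (inj₁ refl) ; adj-right = inj₁ refl ; neighbours = only }
  where
  only : ∀ {j} → j < 3 + m → CycAdjℕ (3 + m) (suc k) j → j ≡ k ⊎ j ≡ 2 + k
  only _ (inj₁ j≡2+k)                 = inj₂ j≡2+k
  only _ (inj₂ (inj₁ e))              = inj₁ (sym (suc-injective e))
  only _ (inj₂ (inj₂ (inj₂ (_ , e)))) = ⊥-elim (k≢1+m (suc-injective e))

cycle-twoNeighbours : ∀ {m} (h : 3 ≤ 3 + m) u → TwoNeighbours (Cycle (3 + m) h) u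
cycle-twoNeighbours {m} h u = record
  { left = fromℕ< left<n ; right = fromℕ< right<n
  ; left<right = subst₂ _<_ (sym (Finₚ.toℕ-fromℕ< left<n)) (sym (Finₚ.toℕ-fromℕ< right<n)) left<right
  ; adj-left = subst (CycAdjℕ (3 + m) (toℕ u)) (sym (Finₚ.toℕ-fromℕ< left<n)) adj-left
  ; adj-right = subst (CycAdjℕ (3 + m) (toℕ u)) (sym (Finₚ.toℕ-fromℕ< right<n)) adj-right
  ; neighbours = only }
  where
  open CycleNeighboursℕ (cycle-neighboursℕ (toℕ u) (Finₚ.toℕ<n u))
  left<n : left < 3 + m
  left<n = <-trans left<right right<n
  only : ∀ {z} → CycAdj _ u z → z ≡ fromℕ< left<n ⊎ z ≡ fromℕ< right<n
  only {z} uz with neighbours (Finₚ.toℕ<n z) uz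
  ... | inj₁ e = inj₁ (Finₚ.toℕ-injective (trans e (sym (Finₚ.toℕ-fromℕ< left<n))))
  ... | inj₂ e = inj₂ (Finₚ.toℕ-injective (trans e (sym (Finₚ.toℕ-fromℕ< right<n))))

cycle-validity≤ : ∀ {m} (h : 3 ≤ 3 + m) π → validity (Cycle (3 + m) h) π ≤ ⌈ 2 + m /2⌉
cycle-validity≤ {m} h π = cycle-independent≤⌈/2⌉ (twoPathsAt G π) (λ u → twoPathsAt-≤1 G π (nb u))
  λ u v uv → +≤1 (twoPathsAt-≤1 G π (nb u)) (twoPathsAt-≤1 G π (nb v)) λ paths-u paths-v →
    localMin-independent G π uv (twoPathsAt⇒localMin G π (nb u) paths-u) (twoPathsAt⇒localMin G π (nb v) paths-v)
  where
  G : Graph (3 + m)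
  G = Cycle _ h
  nb : ∀ u → TwoNeighbours G u
  nb = cycle-twoNeighbours h

identity-localMin⇒zero : ∀ {m} (h : 3 ≤ 3 + m) u → LocalMin (Cycle (3 + m) h) Perm.id u → u ≡ F.zero
identity-localMin⇒zero h F.zero    _     = refl
identity-localMin⇒zero h (F.suc i) min-u = ⊥-elim (<-irrefl refl (<-trans (n<1+n (toℕ i)) i+1<i))
  where
  i+1<i : suc (toℕ i) < toℕ i
  i+1<i = subst (suc (toℕ i) <_) (Finₚ.toℕ-inject₁ i)
            (min-u (inject₁ i) (inj₂ (inj₁ (cong suc (sym (Finₚ.toℕ-inject₁ i))))))

validity-identity : ∀ {m} (h : 3 ≤ 3 + m) → validity (Cycle (3 + m) h) Perm.id ≡ 1
validity-identity {m} h = ≤-antisym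
  (ΣFin-≤1 (twoPathsAt G Perm.id) (λ u → twoPathsAt-≤1 G Perm.id (nb u))
    λ u v paths-u paths-v → trans (zero-of u paths-u) (sym (zero-of v paths-v)))
  (1≤validity G nb Perm.id)
  where
  G : Graph (3 + m)
  G = Cycle _ h
  nb : ∀ u → TwoNeighbours G u
  nb = cycle-twoNeighbours h
  zero-of : ∀ u → 1 ≤ twoPathsAt G Perm.id u → u ≡ F.zero
  zero-of u = identity-localMin⇒zero h u ∘ twoPathsAt⇒localMin G Perm.id (nb u)

swapPairs : ℕ → ℕ → ℕ
swapPairs (suc (suc r)) zero          = 1
swapPairs (suc (suc r)) (suc zero)    = 0
swapPairs (suc (suc r)) (suc (suc k)) = 2 + swapPairs r k
swapPairs _             k             = k

swapPairs-< : ∀ r {k} → k < r → swapPairs r k < r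
swapPairs-< (suc zero)    {zero}        k<r             = k<r
swapPairs-< (suc zero)    {suc k}       (s≤s ())
swapPairs-< (suc (suc r)) {zero}        _               = s≤s (s≤s z≤n)
swapPairs-< (suc (suc r)) {suc zero}    _               = s≤s z≤n
swapPairs-< (suc (suc r)) {suc (suc k)} (s≤s (s≤s k<r)) = s≤s (s≤s (swapPairs-< r k<r))

swapPairs-involutive : ∀ r {k} → k < r → swapPairs r (swapPairs r k) ≡ k
swapPairs-involutive (suc zero)    {zero}        _               = refl
swapPairs-involutive (suc zero)    {suc k}       (s≤s ())
swapPairs-involutive (suc (suc r)) {zero}        _               = refl
swapPairs-involutive (suc (suc r)) {suc zero}    _               = refl
swapPairs-involutive (suc (suc r)) {suc (suc k)} (s≤s (s≤s k<r)) = cong (2 +_) (swapPairs-involutive r k<r)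

swapPairs-even : ∀ r {k} → Even k → suc k < r → swapPairs r k ≡ suc k
swapPairs-even (suc zero)    even-zero    (s≤s ())
swapPairs-even (suc (suc r)) even-zero    _               = refl
swapPairs-even (suc (suc r)) (even-2+ ev) (s≤s (s≤s k<r)) = cong (2 +_) (swapPairs-even r ev k<r)

swapPairs-odd : ∀ r {k} → Even k → suc k < r → swapPairs r (suc k) ≡ k
swapPairs-odd (suc zero)    even-zero    (s≤s ())
swapPairs-odd (suc (suc r)) even-zero    _               = refl
swapPairs-odd (suc (suc r)) (even-2+ ev) (s≤s (s≤s k<r)) = cong (2 +_) (swapPairs-odd r ev k<r)

swapPairs-even-≥ : ∀ r {k} → Even k → k ≤ swapPairs r k
swapPairs-even-≥ r             even-zero    = z≤n
swapPairs-even-≥ zero          (even-2+ ev) = ≤-refl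
swapPairs-even-≥ (suc zero)    (even-2+ ev) = ≤-refl
swapPairs-even-≥ (suc (suc r)) (even-2+ ev) = s≤s (s≤s (swapPairs-even-≥ r ev))

-- The involution (1 2)(3 4)(5 6)⋯ of {0, …, r}: every even vertex k with k + 1 ≤ r becomes a local minimum.
zigzag : ℕ → ℕ → ℕ
zigzag r zero    = zero
zigzag r (suc k) = suc (swapPairs r k)

zigzag-localMin : ∀ {m k j} → Even k → suc k < 3 + m → CycAdjℕ (3 + m) k j → zigzag (2 + m) k < zigzag (2 + m) j
zigzag-localMin {j = zero} even-zero _ (inj₁ ())
zigzag-localMin {j = zero} even-zero _ (inj₂ (inj₁ ()))
zigzag-localMin {j = zero} even-zero _ (inj₂ (inj₂ (inj₁ (_ , ()))))
zigzag-localMin {j = zero} even-zero _ (inj₂ (inj₂ (inj₂ (_ , ()))))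
zigzag-localMin {j = suc j} even-zero _ _ = s≤s z≤n
zigzag-localMin {m} {suc (suc k)} (even-2+ ev) k+3<n (inj₁ refl) = begin-strict
  zigzag (2 + m) (2 + k) ≡⟨ cong suc (swapPairs-odd (2 + m) ev k+1<r) ⟩
  suc k                  <⟨ s≤s (s≤s (n≤1+n k)) ⟩
  3 + k                  ≤⟨ s≤s (swapPairs-even-≥ (2 + m) (even-2+ ev)) ⟩
  zigzag (2 + m) (3 + k) ∎
  where
  open ≤-Reasoning
  k+1<r : suc k < 2 + m
  k+1<r = s≤s⁻¹ (<-trans (n<1+n _) k+3<n)
zigzag-localMin {m} {suc (suc k)} (even-2+ ev) k+3<n (inj₂ (inj₁ refl)) = begin-strict
  zigzag (2 + m) (2 + k) ≡⟨ cong suc (swapPairs-odd (2 + m) ev k+1<r) ⟩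
  suc k                  <⟨ n<1+n _ ⟩
  2 + k                  ≡⟨ cong suc (swapPairs-even (2 + m) ev k+1<r) ⟨
  zigzag (2 + m) (suc k) ∎
  where
  open ≤-Reasoning
  k+1<r : suc k < 2 + m
  k+1<r = s≤s⁻¹ (<-trans (n<1+n _) k+3<n)
zigzag-localMin {m} {suc (suc k)} (even-2+ ev) k+3<n (inj₂ (inj₂ (inj₂ (_ , k+2≡last)))) =
  ⊥-elim (<-irrefl (cong suc k+2≡last) k+3<n)

zigzag-< : ∀ r {k} → k < suc r → zigzag r k < suc r
zigzag-< r {zero}  _         = s≤s z≤n
zigzag-< r {suc k} (s≤s k<r) = s≤s (swapPairs-< r k<r)

zigzag-involutive : ∀ r {k} → k < suc r → zigzag r (zigzag r k) ≡ k
zigzag-involutive r {zero}  _         = refl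
zigzag-involutive r {suc k} (s≤s k<r) = cong suc (swapPairs-involutive r k<r)

module _ {n} (f : ℕ → ℕ) (f-< : ∀ {k} → k < n → f k < n) (f-involutive : ∀ {k} → k < n → f (f k) ≡ k) where

  private
    g : Fin n → Fin n
    g i = fromℕ< (f-< (Finₚ.toℕ<n i))

    toℕ-g : ∀ i → toℕ (g i) ≡ f (toℕ i)
    toℕ-g i = Finₚ.toℕ-fromℕ< _

    g-involutive : ∀ i → g (g i) ≡ i
    g-involutive i = Finₚ.toℕ-injective (begin
      toℕ (g (g i))  ≡⟨ toℕ-g (g i) ⟩
      f (toℕ (g i))  ≡⟨ cong f (toℕ-g i) ⟩
      f (f (toℕ i))  ≡⟨ f-involutive (Finₚ.toℕ<n i) ⟩
      toℕ i          ∎)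
      where open ≡-Reasoning

  involutionPermutation : Numbering n
  involutionPermutation = permutation g g g-involutive g-involutive

  toℕ-involutionPermutation : ∀ i → toℕ (involutionPermutation ⟨$⟩ʳ i) ≡ f (toℕ i)
  toℕ-involutionPermutation = toℕ-g

zigzagNumbering : ∀ m → Numbering (3 + m)
zigzagNumbering m = involutionPermutation (zigzag (2 + m)) (zigzag-< (2 + m)) (zigzag-involutive (2 + m))

validity-zigzag : ∀ {m} (h : 3 ≤ 3 + m) → validity (Cycle (3 + m) h) (zigzagNumbering m) ≡ ⌈ 2 + m /2⌉
validity-zigzag {m} h = ≤-antisym (cycle-validity≤ h σ) (⌊/2⌋≤ΣFin-even (twoPathsAt G σ) λ u ev u+1<n →
  localMin⇒twoPathsAt G σ (cycle-twoNeighbours h u) λ z uz →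
    subst₂ _<_ (sym (toℕ-σ u)) (sym (toℕ-σ z)) (zigzag-localMin ev u+1<n uz))
  where
  G : Graph (3 + m)
  G = Cycle _ h
  σ : Numbering (3 + m)
  σ = zigzagNumbering m
  toℕ-σ : ∀ i → toℕ (σ ⟨$⟩ʳ i) ≡ zigzag (2 + m) (toℕ i)
  toℕ-σ = toℕ-involutionPermutation (zigzag (2 + m)) (zigzag-< (2 + m)) (zigzag-involutive (2 + m))

lemma3 : (n : ℕ) (h : 3 ≤ n) →
    IsPhiMin (Cycle n h) 1 × IsPhiMax (Cycle n h) ⌈ n ∸ 1 /2⌉
lemma3 (suc (suc (suc m))) h =
  ((Perm.id , validity-identity h) , 1≤validity (Cycle _ h) (cycle-twoNeighbours h)) ,
  ((zigzagNumbering m , validity-zigzag h) , cycle-validity≤ h)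
lemma3 (suc zero)       (s≤s ())
lemma3 (suc (suc zero)) (s≤s (s≤s ()))
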